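{- For any graph $G$, $G$ is $(\chi_\ell^*(G), 1/\chi_\ell^*(G))$-flexible.
   Context: All graphs are finite, simple and nonempty. A list assignment $L$ for $G$ assigns to each vertex $v$ a set $L(v)$ of colors; it is a $k$-assignment if $|L(v)|=k$ for all $v$. An $L$-coloring is a function $f$ on $V(G)$ with $f(v)\in L(v)$; it is proper if $f(u)\ne f(v)$ whenever $uv\in E(G)$. An $L$-packing of size $k$ is a set $\{f_1,\dots,f_k\}$ of $L$-colorings with $f_i(v)\neq f_j(v)$ for all $i\ne j$ and all $v$; it is proper if every $f_i$ is proper. The list packing number $\chi_\ell^*(G)$ is the least $k$ such that $G$ has a proper $L$-packing of size $k$ for every $k$-assignment $L$. A request of $L$ is a function $r$ with non-empty domain $D\subseteq V(G)$ such that $r(v)\in L(v)$ for $v\in D$. For $\epsilon\in(0,1]$, $(G,L,r)$ is $\epsilon$-satisfiable if there is a proper $L$-coloring $f$ with $f(v)=r(v)$ for at least $\epsilon|D|$ vertices $v\in D$. $G$ is $(k,\epsilon)$-flexible if $(G,L,r)$ is $\epsilon$-satisfiable for every $k$-assignment $L$ and every request $r$ of $L$. -}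

module Defs where

open import Data.Nat using (ℕ; zero; suc; _≤_; _<_; NonZero)
import Data.Nat as ℕ
open import Data.Integer using (+_)
open import Data.Rational using (ℚ; _/_; _*_) renaming (_≤_ to _≤ℚ_)
open import Data.Fin using (Fin)
open import Data.Fin.Subset using (Subset; Nonempty; ∣_∣) renaming (_∈_ to _∈ₛ_)
open import Data.Bool using (Bool; _∧_)
open import Data.Vec using (tabulate; lookup)
open import Data.List using (List; length)
open import Data.List.Membership.Propositional using (_∈_)
open import Data.List.Relation.Unary.Unique.Propositional using (Unique)
open import Data.Product using (Σ; _×_; ∃)
open import Relation.Binary.PropositionalEquality using (_≡_; _≢_)
open import Relation.Nullary using (¬_)
open import Relation.Nullary.Decidable using (⌊_⌋)

record Graph : Set₁ where
  field
    n        : ℕ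
    nonempty : 1 ≤ n
    Adj      : Fin n → Fin n → Set
    sym      : ∀ {u v} → Adj u v → Adj v u
    irrefl   : ∀ {v} → ¬ Adj v v

open Graph public

-- Colours are natural numbers. A list assignment gives each vertex a list of colours
-- (a set, represented by a duplicate-free list).
ListAssignment : Graph → Set
ListAssignment G = Fin (n G) → List ℕ

IsKAssignment : (G : Graph) → ℕ → ListAssignment G → Set
IsKAssignment G k L = ∀ v → Unique (L v) × length (L v) ≡ k

Colouring : Graph → Set
Colouring G = Fin (n G) → ℕ

IsLColouring : (G : Graph) → ListAssignment G → Colouring G → Set
IsLColouring G L f = ∀ v → f v ∈ L v

IsProper : (G : Graph) → Colouring G → Set
IsProper G f = ∀ u v → Adj G u v → f u ≢ f v

HasProperPacking : (G : Graph) → ListAssignment G → ℕ → Set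
HasProperPacking G L k =
  Σ (Fin k → Colouring G) λ fs →
    (∀ i → IsLColouring G L (fs i) × IsProper G (fs i)) ×
    (∀ i j v → i ≢ j → fs i v ≢ fs j v)

PackingProperty : Graph → ℕ → Set
PackingProperty G k = ∀ L → IsKAssignment G k L → HasProperPacking G L k

IsListPackingNumber : Graph → ℕ → Set
IsListPackingNumber G k =
  1 ≤ k × PackingProperty G k × (∀ j → 1 ≤ j → j < k → ¬ PackingProperty G j)

-- A request of L: non-empty domain D ⊆ V(G), and r(v) ∈ L(v) for v ∈ D
-- (values of r outside D are irrelevant).
record Request (G : Graph) (L : ListAssignment G) : Set where
  field
    D      : Subset (n G)
    D≠∅    : Nonempty D
    r      : Fin (n G) → ℕ
    r∈L    : ∀ v → v ∈ₛ D → r v ∈ L v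

open Request public

agreeSet : {G : Graph} {L : ListAssignment G} → Request G L → Colouring G → Subset (n G)
agreeSet req f = tabulate λ v → lookup (D req) v ∧ ⌊ f v ℕ.≟ r req v ⌋

ℕtoℚ : ℕ → ℚ
ℕtoℚ m = (+ m) / 1

Satisfiable : (G : Graph) (L : ListAssignment G) → Request G L → ℚ → Set
Satisfiable G L req ε =
  ∃ λ (f : Colouring G) → IsLColouring G L f × IsProper G f ×
    (ε * ℕtoℚ ∣ D req ∣ ≤ℚ ℕtoℚ ∣ agreeSet req f ∣)

Flexible : Graph → ℕ → ℚ → Set
Flexible G k ε = ∀ L → IsKAssignment G k L → (req : Request G L) → Satisfiable G L req ε

-- A proper L-packing f₁, …, f_k of a k-assignment offers, at every vertex v, k distinct
-- colours from the k-element list L(v), i.e. all of L(v). So every requested vertex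
-- v ∈ D has r(v) = fᵢ(v) for some i, whence the agreement sets of the fᵢ cover D and
-- one of them has at least |D|/k elements.
module Submission where

open import Defs hiding (sym)
open import Data.Nat using (ℕ; suc; zero; _+_; _*_; _≤_; z≤n; s≤s)
open import Data.Nat.Properties
  using (≤-refl; ≤-trans; ≤-reflexive; <⇒≤; <⇒≱; ≰⇒>; _≤?_; +-suc; +-mono-≤; +-monoʳ-≤;
         *-monoʳ-≤; *-comm; *-identityʳ; ≟-diag; +-0-monoid)
open import Data.Integer using (+_; +≤+)
import Data.Integer as ℤ
import Data.Integer.Properties as ℤ
open import Data.Rational using (_/_; toℚᵘ) renaming (_≤_ to _≤ℚ_; _*_ to _*ℚ_)
open import Data.Rational.Properties using (toℚᵘ-cancel-≤; toℚᵘ-homo-*; toℚᵘ-fromℚᵘ)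
open import Data.Rational.Unnormalised using (mkℚᵘ; *≤*) renaming (_*_ to _*ᵘ_)
open import Data.Rational.Unnormalised.Properties using (*-cong; module ≤-Reasoning)
open import Data.Fin.Base using (Fin; punchOut) renaming (zero to fzero; suc to fsuc)
open import Data.Fin.Properties using (_≟_; any?; injective⇒≤; punchOut-injective)
open import Data.Fin.Subset
  using (Subset; inside; outside; _∪_; ⊥; ∣_∣; _⊆_) renaming (_∈_ to _∈ₛ_)
open import Data.Fin.Subset.Properties using (∣p∣≤∣x∷p∣; ∣⊥∣≡0; p⊆p∪q; q⊆p∪q; p⊆q⇒∣p∣≤∣q∣)
open import Data.Bool.Base using (_∧_)
open import Data.Vec.Base using (_∷_; [])
open import Data.Vec.Properties using (lookup∘tabulate; []=⇒lookup; lookup⇒[]=)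
open import Data.Vec.Functional using (Vector; foldr)
open import Data.List.Base using (List; length)
open import Data.List.Membership.Propositional using (_∈_)
open import Data.List.Membership.Setoid.Properties using (index-injective)
open import Data.List.Relation.Unary.Any using (index)
open import Data.Product using (∃; _,_; proj₁; proj₂)
open import Function.Base using (_∘_)
open import Function.Definitions using (Injective)
open import Relation.Binary.PropositionalEquality
  using (_≡_; _≢_; refl; sym; trans; cong; cong₂; subst; subst₂; setoid)
open import Relation.Nullary using (yes; no; contradiction)
open import Relation.Nullary.Decidable using (⌊_⌋)
open import Algebra.Properties.Monoid.Sum +-0-monoid using (sum; sum-syntax)

∣p∪q∣≤∣p∣+∣q∣ : ∀ {n} (p q : Subset n) → ∣ p ∪ q ∣ ≤ ∣ p ∣ + ∣ q ∣
∣p∪q∣≤∣p∣+∣q∣ []            []            = z≤n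
∣p∪q∣≤∣p∣+∣q∣ (outside ∷ p) (outside ∷ q) = ∣p∪q∣≤∣p∣+∣q∣ p q
∣p∪q∣≤∣p∣+∣q∣ (outside ∷ p) (inside  ∷ q) =
  ≤-trans (s≤s (∣p∪q∣≤∣p∣+∣q∣ p q)) (≤-reflexive (sym (+-suc ∣ p ∣ ∣ q ∣)))
∣p∪q∣≤∣p∣+∣q∣ (inside  ∷ p) (s       ∷ q) =
  s≤s (≤-trans (∣p∪q∣≤∣p∣+∣q∣ p q) (+-monoʳ-≤ ∣ p ∣ (∣p∣≤∣x∷p∣ s q)))

⋃ᵛ : ∀ {k n} → Vector (Subset n) k → Subset n
⋃ᵛ = foldr _∪_ ⊥

p⊆⋃ᵛ : ∀ {k n} (ps : Vector (Subset n) k) i → ps i ⊆ ⋃ᵛ ps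
p⊆⋃ᵛ ps fzero    = p⊆p∪q _
p⊆⋃ᵛ ps (fsuc i) = q⊆p∪q (ps fzero) _ ∘ p⊆⋃ᵛ (λ j → ps (fsuc j)) i

∣⋃ᵛ∣≤∑∣∣ : ∀ {k n} (ps : Vector (Subset n) k) → ∣ ⋃ᵛ ps ∣ ≤ ∑[ i < k ] ∣ ps i ∣
∣⋃ᵛ∣≤∑∣∣ {zero}  {n} ps = ≤-reflexive (∣⊥∣≡0 n)
∣⋃ᵛ∣≤∑∣∣ {suc k}     ps =
  ≤-trans (∣p∪q∣≤∣p∣+∣q∣ (ps fzero) (⋃ᵛ (λ i → ps (fsuc i))))
          (+-monoʳ-≤ ∣ ps fzero ∣ (∣⋃ᵛ∣≤∑∣∣ (λ i → ps (fsuc i))))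

sum≤n*some-term : ∀ m (h : Vector ℕ (suc m)) → ∃ λ i → sum h ≤ suc m * h i
sum≤n*some-term zero    h = fzero , ≤-refl
sum≤n*some-term (suc m) h with sum≤n*some-term m (λ i → h (fsuc i))
... | j , ∑tail≤ with h fzero ≤? h (fsuc j)
... | yes h₀≤hⱼ = fsuc j , +-mono-≤ h₀≤hⱼ ∑tail≤
... | no  h₀≰hⱼ = fzero , +-monoʳ-≤ (h fzero)
                    (≤-trans ∑tail≤ (*-monoʳ-≤ (suc m) (<⇒≤ (≰⇒> h₀≰hⱼ))))

injective⇒surjective : ∀ {m n} {f : Fin m → Fin n} → n ≤ m → Injective _≡_ _≡_ f →
                       ∀ j → ∃ λ i → f i ≡ j
injective⇒surjective {n = suc _} {f = f} n≤m f-inj j with any? (λ i → f i ≟ j)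
... | yes hit = hit
... | no ¬hit = contradiction (injective⇒≤ punchOut∘f-injective) (<⇒≱ n≤m)
  where
  j≢f : ∀ i → j ≢ f i
  j≢f i j≡fi = ¬hit (i , sym j≡fi)

  punchOut∘f-injective : Injective _≡_ _≡_ (λ i → punchOut (j≢f i))
  punchOut∘f-injective eq = f-inj (punchOut-injective (j≢f _) (j≢f _) eq)

pairwise-distinct⇒injective : ∀ {a} {A : Set a} {k} (g : Fin k → A) →
                              (∀ i j → i ≢ j → g i ≢ g j) → Injective _≡_ _≡_ g
pairwise-distinct⇒injective g distinct {i} {j} gi≡gj with i ≟ j
... | yes i≡j = i≡j
... | no  i≢j = contradiction gi≡gj (distinct i j i≢j)

injective-members-exhaust : ∀ {a} {A : Set a} {k} {xs : List A} → length xs ≡ k →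
  (g : Fin k → A) → Injective _≡_ _≡_ g → (∀ i → g i ∈ xs) →
  ∀ {x} → x ∈ xs → ∃ λ i → g i ≡ x
injective-members-exhaust {A = A} refl g g-inj g∈xs x∈xs =
  let i , index≡ = injective⇒surjective ≤-refl index-g-injective (index x∈xs)
  in  i , index-injective (setoid A) (g∈xs i) x∈xs index≡
  where
  index-g-injective : Injective _≡_ _≡_ (λ i → index (g∈xs i))
  index-g-injective eq = g-inj (index-injective (setoid A) (g∈xs _) (g∈xs _) eq)

[1/k]*d≤a : ∀ m {d a} → d ≤ suc m * a → ((+ 1) / suc m) *ℚ ℕtoℚ d ≤ℚ ℕtoℚ a
[1/k]*d≤a m {d} {a} d≤ka = toℚᵘ-cancel-≤ (begin
  toℚᵘ (((+ 1) / suc m) *ℚ ℕtoℚ d)       ≃⟨ toℚᵘ-homo-* ((+ 1) / suc m) (ℕtoℚ d) ⟩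
  toℚᵘ ((+ 1) / suc m) *ᵘ toℚᵘ (ℕtoℚ d)  ≃⟨ *-cong (toℚᵘ-fromℚᵘ (mkℚᵘ (+ 1) m))
                                                    (toℚᵘ-fromℚᵘ (mkℚᵘ (+ d) 0)) ⟩
  mkℚᵘ (+ 1) m *ᵘ mkℚᵘ (+ d) 0          ≤⟨ *≤* cross-multiplied ⟩
  mkℚᵘ (+ a) 0                          ≃⟨ toℚᵘ-fromℚᵘ (mkℚᵘ (+ a) 0) ⟨
  toℚᵘ (ℕtoℚ a)                         ∎)
  where
  open ≤-Reasoning
  cross-multiplied : (+ 1 ℤ.* + d) ℤ.* + 1 ℤ.≤ + a ℤ.* + suc (m * 1)
  cross-multiplied = subst₂ ℤ._≤_
    (sym (trans (ℤ.*-identityʳ _) (ℤ.*-identityˡ (+ d))))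
    (trans (ℤ.pos-* a (suc m)) (cong (λ k → + a ℤ.* + suc k) (sym (*-identityʳ m))))
    (+≤+ (subst (d ≤_) (*-comm (suc m) a) d≤ka))

module _ {G : Graph} {L : ListAssignment G} where

  packing-exhausts-lists : ∀ {k} → IsKAssignment G k L → (fs : Fin k → Colouring G) →
    (∀ i → IsLColouring G L (fs i)) → (∀ i j v → i ≢ j → fs i v ≢ fs j v) →
    ∀ v {c} → c ∈ L v → ∃ λ i → fs i v ≡ c
  packing-exhausts-lists isK fs fs∈L distinct v =
    injective-members-exhaust (proj₂ (isK v)) (λ i → fs i v)
      (pairwise-distinct⇒injective (λ i → fs i v) (λ i j i≢j → distinct i j v i≢j))
      (λ i → fs∈L i v)

  ∈-agreeSet : (req : Request G L) (f : Colouring G) {v : Fin (n G)} →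
               v ∈ₛ D req → f v ≡ r req v → v ∈ₛ agreeSet req f
  ∈-agreeSet req f {v} v∈D fv≡rv = lookup⇒[]= v (agreeSet req f)
    (trans (lookup∘tabulate _ v) (cong₂ _∧_ ([]=⇒lookup v∈D) (cong ⌊_⌋ (≟-diag fv≡rv))))

proposition5 : (G : Graph) (m : ℕ) → IsListPackingNumber G (suc m) →
    Flexible G (suc m) ((+ 1) / suc m)
proposition5 G m (_ , packing , _) L isK req =
  let i , ∑agree≤k*agreeᵢ = sum≤n*some-term m (∣_∣ ∘ agree)
  in  fs i , proj₁ (proper i) , proj₂ (proper i) ,
      [1/k]*d≤a m (≤-trans (p⊆q⇒∣p∣≤∣q∣ D⊆⋃agree) (≤-trans (∣⋃ᵛ∣≤∑∣∣ agree) ∑agree≤k*agreeᵢ))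
  where
  fs       = proj₁ (packing L isK)
  proper   = proj₁ (proj₂ (packing L isK))
  distinct = proj₂ (proj₂ (packing L isK))

  agree : Vector (Subset (n G)) (suc m)
  agree i = agreeSet req (fs i)

  D⊆⋃agree : D req ⊆ ⋃ᵛ agree
  D⊆⋃agree {v} v∈D =
    let j , fⱼv≡rv = packing-exhausts-lists {G} {L} isK fs (proj₁ ∘ proper) distinct v
                       (r∈L req v v∈D)
    in  p⊆⋃ᵛ agree j (∈-agreeSet req (fs j) v∈D fⱼv≡rv)
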